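{- Let $n\ge 0$ and $k\ge -1$. If a container $(S\triangleleft P)$ is $(n,k)$-truncated, then so is its derivative $\partial(S\triangleleft P)$.
   Context: Work in Homotopy Type Theory with a univalent universe. A point $a:A$ is isolated if $a=b$ is decidable for all $b:A$; $A^{\circ}:=\sum_{a:A}\prod_{b:A}\mathrm{Dec}(a=b)$ and $A\setminus a:=\sum_{b:A}\neg(a=b)$. A container $(S\triangleleft P)$ has shapes $S:\mathsf{Type}$ and positions $P:S\to\mathsf{Type}$; it is $(n,k)$-truncated if $S$ is $n$-truncated and every $P_s$ is $k$-truncated (with $-1$-truncated meaning a proposition and $0$-truncated meaning a set). The derivative is $\partial(S\triangleleft P):=((s,p):\sum_{s:S}(P_s)^{\circ}\triangleleft P_s\setminus p)$. -}

module Defs where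

open import Level using (Level; _⊔_)
open import Data.Nat using (ℕ; zero; suc)
open import Data.Product using (Σ; _×_; _,_)
open import Relation.Nullary using (¬_; Dec)
open import Relation.Binary.PropositionalEquality using (_≡_)
open import Data.Container.Core using (Container; _▷_; Shape; Position)

data ℕ₋₂ : Set where
  ⟨-2⟩ : ℕ₋₂
  S    : ℕ₋₂ → ℕ₋₂

⟨-1⟩ : ℕ₋₂
⟨-1⟩ = S ⟨-2⟩

⟨_⟩ : ℕ → ℕ₋₂
⟨ zero ⟩  = S ⟨-1⟩
⟨ suc n ⟩ = S ⟨ n ⟩

is-contr : ∀ {a} → Set a → Set a
is-contr A = Σ A λ x → (y : A) → x ≡ y

is-trunc : ∀ {a} → ℕ₋₂ → Set a → Set a
is-trunc ⟨-2⟩  A = is-contr A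
is-trunc (S n) A = (x y : A) → is-trunc n (x ≡ y)

_° : ∀ {a} → Set a → Set a
A ° = Σ A λ x → (y : A) → Dec (x ≡ y)

_∖_ : ∀ {a} (A : Set a) → A → Set a
A ∖ x = Σ A λ y → ¬ (x ≡ y)

is-trunc-container : ∀ {s p} → ℕ₋₂ → ℕ₋₂ → Container s p → Set (s ⊔ p)
is-trunc-container n k C =
  is-trunc n (Shape C) × ((x : Shape C) → is-trunc k (Position C x))

∂ : ∀ {s p} → Container s p → Container (s ⊔ p) p
∂ C = (Σ (Shape C) λ x → Position C x °) ▷ λ { (x , q) → (Position C x ∖ proj₁′ q) }
  where
  proj₁′ : ∀ {x} → Position C x ° → Position C x
  proj₁′ (q , _) = q

-- A type of isolated points is always a set: paths out of an isolated point are propositions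
-- by a local form of Hedberg's argument, so both the point and its decidability witnesses
-- are propositional data. A set is n-truncated for every n ≥ 0 and Σ preserves
-- n-truncatedness, which handles the shapes Σ S (λ s → (P s)°). The positions P s ∖ p are
-- Σ-types over P s whose fibres are negations, hence propositions, hence k-truncated for
-- every k ≥ -1.
module Submission where

open import Defs
open import Level using (Level)
open import Data.Nat using (ℕ; zero; suc)
open import Data.Product using (Σ; _,_; proj₁)
open import Data.Product.Properties using (Σ-≡,≡→≡; Σ-≡,≡←≡)
open import Data.Empty using (⊥-elim)
open import Relation.Nullary using (¬_; Dec; yes; no; Irrelevant)
open import Relation.Nullary.Decidable.Core using (recompute; recompute-constant)
open import Relation.Binary.PropositionalEquality
  using (_≡_; refl; sym; trans; cong; trans-symˡ; module ≡-Reasoning)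
open import Data.Container.Core using (Container)
open import Axiom.Extensionality.Propositional using (Extensionality)

private
  variable
    a b : Level
    A : Set a
    B : A → Set b

module _ {x : A} (f : ∀ y → x ≡ y → x ≡ y) where

  ≡-canonical : ∀ {y} (p : x ≡ y) → trans (sym (f x refl)) (f y p) ≡ p
  ≡-canonical refl = trans-symˡ (f x refl)

  constant⇒paths-irrelevant : (∀ y (p q : x ≡ y) → f y p ≡ f y q) → ∀ y → Irrelevant (x ≡ y)
  constant⇒paths-irrelevant f-constant y p q = begin
    p                                ≡⟨ sym (≡-canonical p) ⟩
    trans (sym (f x refl)) (f y p)   ≡⟨ cong (trans _) (f-constant y p q) ⟩
    trans (sym (f x refl)) (f y q)   ≡⟨ ≡-canonical q ⟩
    q                                ∎
    where open ≡-Reasoning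

isolated⇒paths-irrelevant : {x : A} → (∀ y → Dec (x ≡ y)) → ∀ y → Irrelevant (x ≡ y)
isolated⇒paths-irrelevant d =
  constant⇒paths-irrelevant (λ y p → recompute (d y) p) (λ y → recompute-constant (d y))

contr⇒irrelevant : is-contr A → Irrelevant A
contr⇒irrelevant (c , c≡) x y = trans (sym (c≡ x)) (c≡ y)

irrelevant⇒paths-irrelevant : Irrelevant A → (x y : A) → Irrelevant (x ≡ y)
irrelevant⇒paths-irrelevant irr x = constant⇒paths-irrelevant (λ y _ → irr x y) (λ _ _ _ → refl)

irrelevant⇒trunc-1 : Irrelevant A → is-trunc ⟨-1⟩ A
irrelevant⇒trunc-1 irr x y = irr x y , irrelevant⇒paths-irrelevant irr x y (irr x y)

trunc-suc : (n : ℕ₋₂) → is-trunc n A → is-trunc (S n) A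
trunc-suc ⟨-2⟩  h = irrelevant⇒trunc-1 (contr⇒irrelevant h)
trunc-suc (S n) h x y = trunc-suc n (h x y)

irrelevant⇒trunc : (k : ℕ₋₂) → Irrelevant A → is-trunc (S k) A
irrelevant⇒trunc ⟨-2⟩  irr = irrelevant⇒trunc-1 irr
irrelevant⇒trunc (S k) irr = trunc-suc (S k) (irrelevant⇒trunc k irr)

set⇒trunc : (n : ℕ) → is-trunc ⟨ 0 ⟩ A → is-trunc ⟨ n ⟩ A
set⇒trunc zero    h = h
set⇒trunc (suc n) h = trunc-suc ⟨ n ⟩ (set⇒trunc n h)

retract-trunc : {B : Set b} (n : ℕ₋₂) (r : B → A) (s : A → B)
  → (∀ x → r (s x) ≡ x) → is-trunc n B → is-trunc n A
retract-trunc ⟨-2⟩ r s rs≡ (c , c≡) = r c , λ y → trans (cong r (c≡ (s y))) (rs≡ y)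
retract-trunc (S n) r s rs≡ h x y =
  retract-trunc n (λ q → trans (sym (rs≡ x)) (trans (cong r q) (rs≡ y))) (cong s) cong-retract
    (h (s x) (s y))
  where
  cong-retract : (p : x ≡ y) → trans (sym (rs≡ x)) (trans (cong r (cong s p)) (rs≡ y)) ≡ p
  cong-retract refl = trans-symˡ (rs≡ x)

Σ-≡,≡→≡∘Σ-≡,≡←≡ : {u v : Σ A B} (p : u ≡ v) → Σ-≡,≡→≡ (Σ-≡,≡←≡ p) ≡ p
Σ-≡,≡→≡∘Σ-≡,≡←≡ refl = refl

Σ-trunc : (n : ℕ₋₂) → is-trunc n A → (∀ x → is-trunc n (B x)) → is-trunc n (Σ A B)
Σ-trunc ⟨-2⟩ (c , c≡) hB =
  (c , proj₁ (hB c)) , λ (y , w) → Σ-≡,≡→≡ (c≡ y , contr⇒irrelevant (hB y) _ _)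
Σ-trunc (S n) hA hB u v =
  retract-trunc n Σ-≡,≡→≡ Σ-≡,≡←≡ Σ-≡,≡→≡∘Σ-≡,≡←≡ (Σ-trunc n (hA _ _) (λ _ → hB _ _ _))

Σ-irrelevant : Irrelevant A → (∀ x → Irrelevant (B x)) → Irrelevant (Σ A B)
Σ-irrelevant irrA irrB (x , u) (y , v) = Σ-≡,≡→≡ (irrA x y , irrB y _ v)

Σ-paths-irrelevant : {u v : Σ A B} → Irrelevant (proj₁ u ≡ proj₁ v)
  → (∀ {x} (w w′ : B x) → Irrelevant (w ≡ w′)) → Irrelevant (u ≡ v)
Σ-paths-irrelevant irr₁ irr₂ p q = begin
  p                             ≡⟨ sym (Σ-≡,≡→≡∘Σ-≡,≡←≡ p) ⟩
  Σ-≡,≡→≡ (Σ-≡,≡←≡ p)           ≡⟨ cong Σ-≡,≡→≡ (Σ-irrelevant irr₁ (λ _ → irr₂ _ _) _ _) ⟩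
  Σ-≡,≡→≡ (Σ-≡,≡←≡ q)           ≡⟨ Σ-≡,≡→≡∘Σ-≡,≡←≡ q ⟩
  q                             ∎
  where open ≡-Reasoning

module _ (funext : ∀ {a b} → Extensionality a b) where

  ¬-irrelevant : Irrelevant (¬ A)
  ¬-irrelevant f g = funext λ x → ⊥-elim (f x)

  Dec-irrelevant : Irrelevant A → Irrelevant (Dec A)
  Dec-irrelevant irr (yes x) (yes y) = cong yes (irr x y)
  Dec-irrelevant irr (yes x) (no ¬y) = ⊥-elim (¬y x)
  Dec-irrelevant irr (no ¬x) (yes y) = ⊥-elim (¬x y)
  Dec-irrelevant irr (no ¬x) (no ¬y) = cong no (¬-irrelevant ¬x ¬y)

  Π-irrelevant : (∀ x → Irrelevant (B x)) → Irrelevant (∀ x → B x)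
  Π-irrelevant irr f g = funext λ x → irr x (f x) (g x)

  isolated-irrelevant : {x : A} → Irrelevant (∀ y → Dec (x ≡ y))
  isolated-irrelevant d e = Π-irrelevant (λ y → Dec-irrelevant (isolated⇒paths-irrelevant d y)) d e

  °-is-set : is-trunc ⟨ 0 ⟩ (A °)
  °-is-set (x , d) (y , e) = irrelevant⇒trunc-1
    (Σ-paths-irrelevant (isolated⇒paths-irrelevant d y)
      (irrelevant⇒paths-irrelevant isolated-irrelevant))

proposition3p8 : (funext : ∀ {a b} → Extensionality a b)
    → {s p : Level} (n : ℕ) (k : ℕ₋₂) → ¬ (k ≡ ⟨-2⟩)
    → (C : Container s p)
    → is-trunc-container ⟨ n ⟩ k C
    → is-trunc-container ⟨ n ⟩ k (∂ C)
proposition3p8 funext n ⟨-2⟩  k≢-2 C _ = ⊥-elim (k≢-2 refl)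
proposition3p8 funext n (S k) _    C (shapes-trunc , positions-trunc) =
  Σ-trunc ⟨ n ⟩ shapes-trunc (λ _ → set⇒trunc n (°-is-set funext)) ,
  λ (x , _) → Σ-trunc (S k) (positions-trunc x) (λ _ → irrelevant⇒trunc k (¬-irrelevant funext))
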